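{- $\mathrm{PEL1}_0 \ne \mathrm{PL}$ and $\mathrm{PEL2}_0 \ne \mathrm{PL}$; that is, neither $\mathrm{PEL1}_0$ nor $\mathrm{PEL2}_0$ is equivalent to $\mathrm{PL}$.
   Context: Formulas are built from propositional variables and constants $\top,\bot$ using $\land$ and $\to$; a sequent is $\Gamma\vdash\phi$ with $\Gamma$ a finite list of formulas. A rule is a derived rule of a logic if it can be obtained as a combination of its inference rules; $A\le B$ means every inference rule of $A$ is a derived rule of $B$; $A$ and $B$ are equivalent if $A\le B$ and $B\le A$. $\mathrm{PL}$ has the rules: $\vdash\top$; $\phi\vdash\phi$; from $\Gamma\vdash\psi$ infer $\Gamma,\phi\vdash\psi$; from $\Gamma\vdash\phi$ and $\Gamma,\phi\vdash\psi$ infer $\Gamma\vdash\psi$; from $\Gamma\vdash\phi\land\psi$ infer $\Gamma\vdash\phi$ and $\Gamma\vdash\psi$; from $\Gamma\vdash\phi$ and $\Gamma\vdash\psi$ infer $\Gamma\vdash\phi\land\psi$; from $\Gamma\vdash\phi$ and $\Gamma\vdash\phi\to\psi$ infer $\Gamma\vdash\psi$; from $\Gamma\vdash\psi$ infer $\Gamma\vdash\phi\to\psi$. $\mathrm{PEL1}_0$ is $\mathrm{PL}$ plus (E1$_0$): from $\phi\vdash\psi$ and $\psi\vdash\phi$ infer $(\phi\to\chi)\vdash(\psi\to\chi)$. $\mathrm{PEL2}_0$ is $\mathrm{PL}$ plus (E2$_0$): from $\phi\vdash\psi$ and $\psi\vdash\phi$ infer $(\chi\to\phi)\vdash(\chi\to\psi)$.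 -}

module Defs where

open import Data.Nat using (ℕ)
open import Data.List using (List; []; _∷_; [_]; _∷ʳ_)
open import Data.List.Membership.Propositional using (_∈_)
open import Data.List.Relation.Unary.All using (All)
open import Data.Sum using (_⊎_)
open import Data.Product using (_×_)

data Form : Set where
  var  : ℕ → Form
  top  : Form
  bot  : Form
  _∧'_ : Form → Form → Form
  _⇒_  : Form → Form → Form

infixr 6 _∧'_
infixr 5 _⇒_

Ctx : Set
Ctx = List Form

-- Sequents Γ ⊢ φ ; the context extension "Γ , φ" appends φ at the end.
infix 4 _⊢_
data Seq : Set where
  _⊢_ : Ctx → Form → Seq

-- A logic is given by (the instances of) its inference rules:
-- L ps c  means "from premises ps infer conclusion c" is an instance of a rule of L.
Logic : Set₁
Logic = List Seq → Seq → Set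

data PL : Logic where
  topI   : PL [] ([] ⊢ top)
  ax     : ∀ {φ} → PL [] ([ φ ] ⊢ φ)
  weak   : ∀ {Γ φ ψ} → PL [ Γ ⊢ ψ ] (Γ ∷ʳ φ ⊢ ψ)
  cut    : ∀ {Γ φ ψ} → PL ((Γ ⊢ φ) ∷ (Γ ∷ʳ φ ⊢ ψ) ∷ []) (Γ ⊢ ψ)
  andE₁  : ∀ {Γ φ ψ} → PL [ Γ ⊢ φ ∧' ψ ] (Γ ⊢ φ)
  andE₂  : ∀ {Γ φ ψ} → PL [ Γ ⊢ φ ∧' ψ ] (Γ ⊢ ψ)
  andI   : ∀ {Γ φ ψ} → PL ((Γ ⊢ φ) ∷ (Γ ⊢ ψ) ∷ []) (Γ ⊢ φ ∧' ψ)
  impE   : ∀ {Γ φ ψ} → PL ((Γ ⊢ φ) ∷ (Γ ⊢ φ ⇒ ψ) ∷ []) (Γ ⊢ ψ)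
  impI   : ∀ {Γ φ ψ} → PL [ Γ ⊢ ψ ] (Γ ⊢ φ ⇒ ψ)

data E1₀ : Logic where
  e1 : ∀ {φ ψ χ} → E1₀ (([ φ ] ⊢ ψ) ∷ ([ ψ ] ⊢ φ) ∷ []) ([ φ ⇒ χ ] ⊢ ψ ⇒ χ)

data E2₀ : Logic where
  e2 : ∀ {φ ψ χ} → E2₀ (([ φ ] ⊢ ψ) ∷ ([ ψ ] ⊢ φ) ∷ []) ([ χ ⇒ φ ] ⊢ χ ⇒ ψ)

_∪_ : Logic → Logic → Logic
(A ∪ B) ps c = A ps c ⊎ B ps c

PEL1₀ : Logic
PEL1₀ = PL ∪ E1₀

PEL2₀ : Logic
PEL2₀ = PL ∪ E2₀

data Deriv (L : Logic) (H : List Seq) : Seq → Set where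
  hyp : ∀ {s} → s ∈ H → Deriv L H s
  by  : ∀ {ps c} → L ps c → All (Deriv L H) ps → Deriv L H c

Derived : Logic → List Seq → Seq → Set
Derived L ps c = Deriv L ps c

_≤L_ : Logic → Logic → Set
A ≤L B = ∀ ps c → A ps c → Derived B ps c

_≅L_ : Logic → Logic → Set
A ≅L B = (A ≤L B) × (B ≤L A)

-- PL constrains an implication a ⇒ b only to lie between b and the material
-- conditional, so its rules are sound for valuations that are not congruential
-- in the arguments of ⇒. Reading a ⇒ b as plain b whenever a or b is a
-- conjunction gives such a valuation, under which the equivalent formulas p and
-- p ∧ p are not interchangeable: p ⇒ ⊥ holds while p ∧ p ⇒ ⊥ fails, and ⊥ ⇒ p
-- holds while ⊥ ⇒ p ∧ p fails.
module Submission where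

open import Defs
open import Data.Bool using (Bool; true; false; T; not; _∧_; _∨_; if_then_else_)
open import Data.Bool.Properties using (T-∧; T-∨)
open import Data.List using (List; []; _∷_; [_])
open import Data.List.Relation.Unary.All using (All; []; _∷_; lookup)
open import Data.List.Relation.Unary.All.Properties using (∷ʳ⁺; ∷ʳ⁻)
open import Data.Product using (_×_; _,_; proj₁; proj₂)
open import Data.Sum using (inj₂)
open import Data.Unit using (tt)
open import Function.Bundles using (Equivalence)
open import Relation.Nullary using (¬_)

open Equivalence using (to; from)

record IsPLValuation (v : Form → Bool) : Set where
  field
    top-true : T (v top)
    ∧-intro  : ∀ {a b} → T (v a) → T (v b) → T (v (a ∧' b))
    ∧-elimˡ  : ∀ {a b} → T (v (a ∧' b)) → T (v a)
    ∧-elimʳ  : ∀ {a b} → T (v (a ∧' b)) → T (v b)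
    ⇒-intro  : ∀ {a b} → T (v b) → T (v (a ⇒ b))
    ⇒-elim   : ∀ {a b} → T (v a) → T (v (a ⇒ b)) → T (v b)

Valid : (Form → Bool) → Seq → Set
Valid v (Γ ⊢ φ) = All (λ γ → T (v γ)) Γ → T (v φ)

module _ {v : Form → Bool} (isPL : IsPLValuation v) where
  open IsPLValuation isPL

  Derived-PL-valid : ∀ {H s} → All (Valid v) H → Derived PL H s → Valid v s
  Derived-PL-valid hs (hyp s∈H) = lookup hs s∈H
  Derived-PL-valid hs (by topI [])             _ = top-true
  Derived-PL-valid hs (by ax [])               (t ∷ []) = t
  Derived-PL-valid hs (by weak (d ∷ []))       Γ⊨ = Derived-PL-valid hs d (proj₁ (∷ʳ⁻ Γ⊨))
  Derived-PL-valid hs (by cut (d ∷ e ∷ []))    Γ⊨ =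
    Derived-PL-valid hs e (∷ʳ⁺ Γ⊨ (Derived-PL-valid hs d Γ⊨))
  Derived-PL-valid hs (by andE₁ (d ∷ []))      Γ⊨ = ∧-elimˡ (Derived-PL-valid hs d Γ⊨)
  Derived-PL-valid hs (by andE₂ (d ∷ []))      Γ⊨ = ∧-elimʳ (Derived-PL-valid hs d Γ⊨)
  Derived-PL-valid hs (by andI (d ∷ e ∷ []))   Γ⊨ =
    ∧-intro (Derived-PL-valid hs d Γ⊨) (Derived-PL-valid hs e Γ⊨)
  Derived-PL-valid hs (by impE (d ∷ e ∷ []))   Γ⊨ =
    ⇒-elim (Derived-PL-valid hs d Γ⊨) (Derived-PL-valid hs e Γ⊨)
  Derived-PL-valid hs (by impI (d ∷ []))       Γ⊨ = ⇒-intro (Derived-PL-valid hs d Γ⊨)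

isConj : Form → Bool
isConj (_ ∧' _) = true
isConj _        = false

eval : Form → Bool
eval (var _)  = false
eval top      = true
eval bot      = false
eval (a ∧' b) = eval a ∧ eval b
eval (a ⇒ b)  = if isConj a ∨ isConj b then eval b else not (eval a) ∨ eval b

eval-⇒-intro : ∀ {a b} → T (eval b) → T (eval (a ⇒ b))
eval-⇒-intro {a} {b} tb with isConj a ∨ isConj b
... | true  = tb
... | false = from T-∨ (inj₂ tb)

eval-⇒-elim : ∀ {a b} → T (eval a) → T (eval (a ⇒ b)) → T (eval b)
eval-⇒-elim {a} {b} ta tab with isConj a ∨ isConj b | eval a | eval b
... | true  | _    | _    = tab
... | false | true | true = tt

eval-isPLValuation : IsPLValuation eval
eval-isPLValuation = record
  { top-true = tt
  ; ∧-intro  = λ ta tb → from T-∧ (ta , tb)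
  ; ∧-elimˡ  = λ tab → proj₁ (to T-∧ tab)
  ; ∧-elimʳ  = λ tab → proj₂ (to T-∧ tab)
  ; ⇒-intro  = λ {a} {b} → eval-⇒-intro {a} {b}
  ; ⇒-elim   = λ {a} {b} → eval-⇒-elim {a} {b}
  }

p : Form
p = var 0

p⊣⊢p∧p : List Seq
p⊣⊢p∧p = ([ p ] ⊢ p ∧' p) ∷ ([ p ∧' p ] ⊢ p) ∷ []

p⊣⊢p∧p-valid : All (Valid eval) p⊣⊢p∧p
p⊣⊢p∧p-valid = (λ { (() ∷ []) }) ∷ (λ { (() ∷ []) }) ∷ []

E1₀-not-derived-in-PL : ¬ Derived PL p⊣⊢p∧p ([ p ⇒ bot ] ⊢ p ∧' p ⇒ bot)
E1₀-not-derived-in-PL d = Derived-PL-valid eval-isPLValuation p⊣⊢p∧p-valid d (tt ∷ [])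

E2₀-not-derived-in-PL : ¬ Derived PL p⊣⊢p∧p ([ bot ⇒ p ] ⊢ bot ⇒ p ∧' p)
E2₀-not-derived-in-PL d = Derived-PL-valid eval-isPLValuation p⊣⊢p∧p-valid d (tt ∷ [])

lemma5p3 : (¬ (PEL1₀ ≅L PL)) × (¬ (PEL2₀ ≅L PL))
lemma5p3 = (λ (PEL1₀≤PL , _) → E1₀-not-derived-in-PL (PEL1₀≤PL _ _ (inj₂ e1)))
         , (λ (PEL2₀≤PL , _) → E2₀-not-derived-in-PL (PEL2₀≤PL _ _ (inj₂ e2)))
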